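{- Let $G$ be a group and $H \leq A \leq G$. Then $A$ is a total perfect code of $(G,H)$ if and only if there exists a right transversal $Y$ of $A$ in $G$ such that $Y^{ -1}H=HY$ and $Y$ contains an element in $A\setminus H$.
   Context: All groups are finite. For a group $G$, a subgroup $H\leq G$ and a subset $U\subseteq G$ which is a union of double cosets of $H$ with $H\cap U=\emptyset$ and $U^{ -1}=U$, the coset graph $\mathrm{Cos}(G,H,U)$ has as vertex set the set of left cosets of $H$ in $G$, with $g_1H$ and $g_2H$ adjacent iff $g_1^{ -1}g_2\in U$. A total perfect code in a graph is a set $C$ of vertices such that every vertex is adjacent to exactly one vertex of $C$. For $H\leq A\leq G$, $A$ is called a total perfect code of the pair $(G,H)$ if there is a coset graph $\mathrm{Cos}(G,H,U)$ in which the set $\{aH: a\in A\}$ of left cosets of $H$ contained in $A$ is a total perfect code. -}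

module Defs where

open import Data.Nat using (ℕ)
open import Data.Fin using (Fin)
open import Data.Fin.Subset using (Subset; _∈_; _∉_)
open import Data.Product using (Σ; _×_; ∃-syntax)
open import Relation.Binary.PropositionalEquality using (_≡_)
open import Algebra.Structures using (IsGroup)

-- A finite group, presented (up to isomorphism) on the carrier Fin n
-- with propositional equality.
record FinGroup : Set where
  infixl 7 _∙_
  field
    n       : ℕ
    _∙_     : Fin n → Fin n → Fin n
    ε       : Fin n
    _⁻¹     : Fin n → Fin n
    isGroup : IsGroup _≡_ _∙_ ε _⁻¹

module _ (G : FinGroup) where
  open FinGroup G

  Sub : Set
  Sub = Subset n

  IsSubgroup : Sub → Set
  IsSubgroup H = (ε ∈ H)
               × (∀ x y → x ∈ H → y ∈ H → (x ∙ y) ∈ H)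
               × (∀ x → x ∈ H → (x ⁻¹) ∈ H)

  _⊆G_ : Sub → Sub → Set
  S ⊆G T = ∀ x → x ∈ S → x ∈ T

  SameLeftCoset : Sub → Fin n → Fin n → Set
  SameLeftCoset H x y = ((x ⁻¹) ∙ y) ∈ H

  -- U is an admissible connection set for a coset graph Cos(G,H,U):
  -- U is a union of double cosets HuH, H ∩ U = ∅, and U⁻¹ = U.
  IsCosetGraphSet : Sub → Sub → Set
  IsCosetGraphSet H U =
      (∀ h u h' → h ∈ H → u ∈ U → h' ∈ H → (h ∙ u ∙ h') ∈ U)
    × (∀ x → x ∈ H → x ∉ U)
    × (∀ u → u ∈ U → (u ⁻¹) ∈ U)

  -- Adjacency in Cos(G,H,U) between the vertices xH and yH
  -- (well defined on cosets since U is a union of double cosets of H).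
  Adjacent : Sub → Fin n → Fin n → Set
  Adjacent U x y = ((x ⁻¹) ∙ y) ∈ U

  -- The set of vertices { aH : a ∈ A } is a total perfect code of
  -- Cos(G,H,U): every vertex gH is adjacent to exactly one vertex aH
  -- with a ∈ A (cosets compared via SameLeftCoset).
  IsTotalPerfectCodeOfCos : Sub → Sub → Sub → Set
  IsTotalPerfectCodeOfCos H U A =
    ∀ g → Σ (Fin n) λ a → (a ∈ A) × Adjacent U g a
          × (∀ a' → a' ∈ A → Adjacent U g a' → SameLeftCoset H a a')

  IsTotalPerfectCodeOfPair : Sub → Sub → Set
  IsTotalPerfectCodeOfPair H A =
    Σ Sub λ U → IsCosetGraphSet H U × IsTotalPerfectCodeOfCos H U A

  -- Y is a right transversal of A in G: Y contains exactly one element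
  -- of each right coset Ag (y ∈ Ag iff y g⁻¹ ∈ A).
  IsRightTransversal : Sub → Sub → Set
  IsRightTransversal A Y =
      (∀ g → Σ (Fin n) λ y → (y ∈ Y) × ((y ∙ (g ⁻¹)) ∈ A))
    × (∀ y y' → y ∈ Y → y' ∈ Y → (y' ∙ (y ⁻¹)) ∈ A → y ≡ y')

  InvProdEqProd : Sub → Sub → Set
  InvProdEqProd Y H =
      (∀ y h → y ∈ Y → h ∈ H →
         Σ (Fin n) λ h' → Σ (Fin n) λ y' → (h' ∈ H) × (y' ∈ Y) × ((y ⁻¹) ∙ h ≡ h' ∙ y'))
    × (∀ h y → h ∈ H → y ∈ Y →
         Σ (Fin n) λ y' → Σ (Fin n) λ h' → (y' ∈ Y) × (h' ∈ H) × (h ∙ y ≡ (y' ⁻¹) ∙ h'))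

-- For a connection set U, the code {aH : a ∈ A} is total perfect exactly when U meets every
-- left coset gA of A, and meets it inside a single left coset of H. Picking one element of U
-- in each coset gA (canonically, the least one) gives Y⁻¹ for a right transversal Y of A,
-- and then U = Y⁻¹H; conversely U := Y⁻¹H is a suitable connection set for any such Y.
-- Since (Y⁻¹H)⁻¹ = HY, the condition Y⁻¹H = HY is U⁻¹ = U, and the element of Y in A ∖ H
-- is what keeps U disjoint from H.

module Submission where

open import Level using (0ℓ)
open import Data.Nat using (ℕ)
open import Data.Fin using (Fin; _<_; inject; fromℕ<)
open import Data.Fin.Properties
  using (any?; all?; _<?_; <-cmp; ¬∀⟶∃¬-smallest; toℕ-injective; toℕ-inject; toℕ-fromℕ<)
open import Data.Fin.Subset using (Subset; _∈_; _∉_)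
open import Data.Fin.Subset.Properties using (_∈?_)
open import Data.Bool using (true)
open import Data.Vec using (tabulate)
open import Data.Vec.Properties using (lookup∘tabulate; []=⇒lookup; lookup⇒[]=)
open import Data.Product using (Σ; _×_; _,_; proj₁; proj₂; ∃)
open import Function using (_∘_; _⇔_; mk⇔)
open import Relation.Binary using (tri<; tri≈; tri>)
open import Relation.Nullary using (¬_; Dec; yes; no; does; contradiction)
open import Relation.Nullary.Decidable
  using (_×-dec_; _→-dec_; ¬?; dec-true; decidable-stable)
open import Relation.Unary using (Pred; Decidable; _≐_; _⊆_)
open import Relation.Binary.PropositionalEquality
open import Algebra.Bundles using (Group)
open import Algebra.Structures using (IsGroup)
import Algebra.Properties.Group as GroupProperties
open import Defs

module _ {n : ℕ} {P : Pred (Fin n) 0ℓ} (P? : Decidable P) where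

  toSubset : Subset n
  toSubset = tabulate (does ∘ P?)

  ∈-toSubset⁺ : ∀ {i} → P i → i ∈ toSubset
  ∈-toSubset⁺ {i} p = lookup⇒[]= i toSubset (trans (lookup∘tabulate _ i) (dec-true (P? i) p))

  ∈-toSubset⁻ : ∀ {i} → i ∈ toSubset → P i
  ∈-toSubset⁻ {i} i∈ = fromDoes (P? i) (trans (sym (lookup∘tabulate _ i)) ([]=⇒lookup i∈))
    where
    fromDoes : (p? : Dec (P i)) → does p? ≡ true → P i
    fromDoes (yes p) _ = p
    fromDoes (no _) ()

IsLeast : ∀ {n} → Pred (Fin n) 0ℓ → Fin n → Set
IsLeast P i = P i × (∀ j → j < i → ¬ P j)

module _ {n : ℕ} {P : Pred (Fin n) 0ℓ} where

  isLeast? : Decidable P → Decidable (IsLeast P)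
  isLeast? P? i = P? i ×-dec all? (λ j → (j <? i) →-dec ¬? (P? j))

  least : Decidable P → ∃ P → ∃ (IsLeast P)
  least P? (w , pw) with ¬∀⟶∃¬-smallest n (¬_ ∘ P) (¬? ∘ P?) (λ ∀¬P → ∀¬P w pw)
  ... | i , ¬¬pi , below = i , decidable-stable (P? i) ¬¬pi , below′
    where
    below′ : ∀ j → j < i → ¬ P j
    below′ j j<i = subst (¬_ ∘ P) inject-fromℕ< (below (fromℕ< j<i))
      where
      inject-fromℕ< : inject (fromℕ< j<i) ≡ j
      inject-fromℕ< = toℕ-injective (trans (toℕ-inject (fromℕ< j<i)) (toℕ-fromℕ< j<i))

  isLeast-resp-≐ : ∀ {Q i} → P ≐ Q → IsLeast P i → IsLeast Q i
  isLeast-resp-≐ (P⊆Q , Q⊆P) (pi , below) = P⊆Q pi , λ j j<i → below j j<i ∘ Q⊆P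

  isLeast-unique : ∀ {i j} → IsLeast P i → IsLeast P j → i ≡ j
  isLeast-unique {i} {j} (pi , i-below) (pj , j-below) with <-cmp i j
  ... | tri< i<j _ _ = contradiction pi (j-below i i<j)
  ... | tri≈ _ i≡j _ = i≡j
  ... | tri> _ _ j<i = contradiction pj (i-below j j<i)

module _ (G : FinGroup) where
  open FinGroup G
  open IsGroup isGroup using (assoc; identityˡ; identityʳ; inverseʳ)

  group : Group 0ℓ 0ℓ
  group = record { Carrier = Fin n ; _≈_ = _≡_ ; _∙_ = _∙_ ; ε = ε ; _⁻¹ = _⁻¹ ; isGroup = isGroup }

  open GroupProperties group
    using (\\-leftDividesˡ; \\-leftDividesʳ; //-rightDividesʳ; ⁻¹-involutive; ⁻¹-injective;
           ⁻¹-anti-homo-∙; ⁻¹-anti-homo-//; ⁻¹-anti-homo-\\; ε⁻¹≈ε)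

  SameRightCoset : Sub G → Fin n → Fin n → Set
  SameRightCoset S x y = x ∙ y ⁻¹ ∈ S

  module _ {S : Sub G} (sS : IsSubgroup G S) where

    ε∈ : ε ∈ S
    ε∈ = proj₁ sS

    ∙-closed : ∀ {x y} → x ∈ S → y ∈ S → x ∙ y ∈ S
    ∙-closed = proj₁ (proj₂ sS) _ _

    ⁻¹-closed : ∀ {x} → x ∈ S → x ⁻¹ ∈ S
    ⁻¹-closed = proj₂ (proj₂ sS) _

    ∈-cancelʳ : ∀ {x y} → x ∙ y ∈ S → y ∈ S → x ∈ S
    ∈-cancelʳ {x} {y} xy∈ y∈ = subst (_∈ S) (//-rightDividesʳ y x) (∙-closed xy∈ (⁻¹-closed y∈))

    sameRightCoset-∙ : ∀ {x y w} → SameRightCoset S x y → y ∙ w ∈ S → x ∙ w ∈ S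
    sameRightCoset-∙ {x} {y} {w} x∼y yw∈ = subst (_∈ S) eq (∙-closed x∼y yw∈)
      where
      eq : x ∙ y ⁻¹ ∙ (y ∙ w) ≡ x ∙ w
      eq = trans (assoc x (y ⁻¹) (y ∙ w)) (cong (x ∙_) (\\-leftDividesʳ y w))

    sameRightCoset-sym : ∀ {x y} → SameRightCoset S x y → SameRightCoset S y x
    sameRightCoset-sym {x} {y} x∼y = subst (_∈ S) (⁻¹-anti-homo-// x y) (⁻¹-closed x∼y)

    sameRightCoset-trans : ∀ {x y z} → SameRightCoset S x y → SameRightCoset S y z →
                           SameRightCoset S x z
    sameRightCoset-trans = sameRightCoset-∙

    sameRightCoset-ε : ∀ {x} → SameRightCoset S x ε → x ∈ S
    sameRightCoset-ε {x} = subst (_∈ S) (trans (cong (x ∙_) ε⁻¹≈ε) (identityʳ x))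

  -- u ∈ Y⁻¹H
  InvProd : Sub G → Sub G → Pred (Fin n) 0ℓ
  InvProd Y H u = Σ (Fin n) λ y → y ∈ Y × y ∙ u ∈ H

  invProd? : (Y H : Sub G) → Decidable (InvProd Y H)
  invProd? Y H u = any? λ y → (y ∈? Y) ×-dec (y ∙ u ∈? H)

  module _ {Y H : Sub G} where

    invProd-intro : ∀ {y h} → y ∈ Y → h ∈ H → InvProd Y H (y ⁻¹ ∙ h)
    invProd-intro {y} {h} y∈ h∈ = y , y∈ , subst (_∈ H) (sym (\\-leftDividesˡ y h)) h∈

    invProd-form : ∀ {u} → InvProd Y H u →
                   Σ (Fin n) λ y → Σ (Fin n) λ h → y ∈ Y × h ∈ H × u ≡ y ⁻¹ ∙ h
    invProd-form {u} (y , y∈ , yu∈) = y , y ∙ u , y∈ , yu∈ , sym (\\-leftDividesʳ y u)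

    invProd-∙ʳ : ∀ {u h} → IsSubgroup G H → InvProd Y H u → h ∈ H → InvProd Y H (u ∙ h)
    invProd-∙ʳ {u} {h} sH (y , y∈ , yu∈) h∈ =
      y , y∈ , subst (_∈ H) (assoc y u h) (∙-closed sH yu∈ h∈)

    InverseClosed : Set
    InverseClosed = ∀ {u} → InvProd Y H u → InvProd Y H (u ⁻¹)

    invProdEqProd⇒inverseClosed : IsSubgroup G H → InvProdEqProd G Y H → InverseClosed
    invProdEqProd⇒inverseClosed sH (⊆HY , _) u∈ with invProd-form u∈
    ... | y , h , y∈ , h∈ , refl with ⊆HY y h y∈ h∈
    ... | h′ , y′ , h′∈ , y′∈ , eq =
      subst (InvProd Y H) (sym u⁻¹≡) (invProd-intro y′∈ (⁻¹-closed sH h′∈))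
      where
      u⁻¹≡ : (y ⁻¹ ∙ h) ⁻¹ ≡ y′ ⁻¹ ∙ h′ ⁻¹
      u⁻¹≡ = trans (cong _⁻¹ eq) (⁻¹-anti-homo-∙ h′ y′)

    inverseClosed⇒invProdEqProd : IsSubgroup G H → InverseClosed → InvProdEqProd G Y H
    inverseClosed⇒invProdEqProd sH closed = ⊆HY , HY⊆
      where
      ⊆HY : ∀ y h → y ∈ Y → h ∈ H →
            Σ (Fin n) λ h′ → Σ (Fin n) λ y′ → h′ ∈ H × y′ ∈ Y × y ⁻¹ ∙ h ≡ h′ ∙ y′
      ⊆HY y h y∈ h∈ with invProd-form (closed (invProd-intro {h = h} y∈ h∈))
      ... | y′ , k , y′∈ , k∈ , eq = k ⁻¹ , y′ , ⁻¹-closed sH k∈ , y′∈ , y⁻¹h≡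
        where
        open ≡-Reasoning
        y⁻¹h≡ : y ⁻¹ ∙ h ≡ k ⁻¹ ∙ y′
        y⁻¹h≡ = begin
          y ⁻¹ ∙ h           ≡⟨ ⁻¹-involutive (y ⁻¹ ∙ h) ⟨
          (y ⁻¹ ∙ h) ⁻¹ ⁻¹   ≡⟨ cong _⁻¹ eq ⟩
          (y′ ⁻¹ ∙ k) ⁻¹     ≡⟨ ⁻¹-anti-homo-\\ y′ k ⟩
          k ⁻¹ ∙ y′          ∎

      HY⊆ : ∀ h y → h ∈ H → y ∈ Y →
            Σ (Fin n) λ y′ → Σ (Fin n) λ h′ → y′ ∈ Y × h′ ∈ H × h ∙ y ≡ y′ ⁻¹ ∙ h′
      HY⊆ h y h∈ y∈ with invProd-form (closed (subst (InvProd Y H) (sym (⁻¹-anti-homo-∙ h y))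
                                                 (invProd-intro y∈ (⁻¹-closed sH h∈))))
      ... | y′ , k , y′∈ , k∈ , eq = y′ , k , y′∈ , k∈ , trans (sym (⁻¹-involutive (h ∙ y))) eq

    invProd-∙ˡ : ∀ {h u} → IsSubgroup G H → InverseClosed → h ∈ H → InvProd Y H u →
                 InvProd Y H (h ∙ u)
    invProd-∙ˡ {h} {u} sH closed h∈ u∈ =
      subst (InvProd Y H) eq (closed (invProd-∙ʳ sH (closed u∈) (⁻¹-closed sH h∈)))
      where
      eq : (u ⁻¹ ∙ h ⁻¹) ⁻¹ ≡ h ∙ u
      eq = trans (⁻¹-anti-homo-∙ (u ⁻¹) (h ⁻¹)) (cong₂ _∙_ (⁻¹-involutive h) (⁻¹-involutive u))

  module CodeToTransversal {H A U : Sub G} (sH : IsSubgroup G H) (sA : IsSubgroup G A)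
    (conn : IsCosetGraphSet G H U) (code : IsTotalPerfectCodeOfCos G H U A) where

    code-meets : ∀ g → Σ (Fin n) λ z → z ∈ U × g ∙ z ∈ A
    code-meets g with code g
    ... | a , a∈ , adj , _ = g ⁻¹ ∙ a , adj , subst (_∈ A) (sym (\\-leftDividesˡ g a)) a∈

    -- The vertex z₁⁻¹H is adjacent to the code vertices H and z₁⁻¹z₂H, which must therefore coincide.
    code-sameLeftCoset : ∀ {z₁ z₂} → z₁ ∈ U → z₂ ∈ U →
                         SameLeftCoset G A z₁ z₂ → SameLeftCoset G H z₁ z₂
    code-sameLeftCoset {z₁} {z₂} z₁∈ z₂∈ z₁⁻¹z₂∈ with code (z₁ ⁻¹)
    ... | a , _ , _ , unique = subst (_∈ H) eq (∙-closed sH (⁻¹-closed sH a⁻¹∈) a⁻¹z₁⁻¹z₂∈)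
      where
      adjacent : ∀ {w} → z₁ ∙ w ∈ U → Adjacent G U (z₁ ⁻¹) w
      adjacent = subst (λ x → x ∙ _ ∈ U) (sym (⁻¹-involutive z₁))
      a⁻¹∈ : a ⁻¹ ∙ ε ∈ H
      a⁻¹∈ = unique ε (ε∈ sA) (adjacent (subst (_∈ U) (sym (identityʳ z₁)) z₁∈))
      a⁻¹z₁⁻¹z₂∈ : a ⁻¹ ∙ (z₁ ⁻¹ ∙ z₂) ∈ H
      a⁻¹z₁⁻¹z₂∈ = unique _ z₁⁻¹z₂∈ (adjacent (subst (_∈ U) (sym (\\-leftDividesˡ z₁ z₂)) z₂∈))
      eq : (a ⁻¹ ∙ ε) ⁻¹ ∙ (a ⁻¹ ∙ (z₁ ⁻¹ ∙ z₂)) ≡ z₁ ⁻¹ ∙ z₂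
      eq = trans (cong (λ x → x ⁻¹ ∙ (a ⁻¹ ∙ (z₁ ⁻¹ ∙ z₂))) (identityʳ (a ⁻¹)))
                 (\\-leftDividesʳ (a ⁻¹) _)

    Meets : Fin n → Pred (Fin n) 0ℓ
    Meets g z = z ∈ U × g ∙ z ∈ A

    meets? : ∀ g → Decidable (Meets g)
    meets? g z = (z ∈? U) ×-dec (g ∙ z ∈? A)

    meets-resp : ∀ {g g′} → SameRightCoset A g′ g → Meets g ≐ Meets g′
    meets-resp g′∼g =
        (λ (z∈ , gz∈) → z∈ , sameRightCoset-∙ sA g′∼g gz∈)
      , (λ (z∈ , g′z∈) → z∈ , sameRightCoset-∙ sA (sameRightCoset-sym sA g′∼g) g′z∈)

    -- Taking least elements makes the choice of y⁻¹ ∈ U ∩ y⁻¹A depend only on the coset y⁻¹A.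
    IsRep : Pred (Fin n) 0ℓ
    IsRep y = IsLeast (Meets y) (y ⁻¹)

    isRep? : Decidable IsRep
    isRep? y = isLeast? (meets? y) (y ⁻¹)

    Y : Sub G
    Y = toSubset isRep?

    Y⁻¹⊆U : ∀ {y} → y ∈ Y → y ⁻¹ ∈ U
    Y⁻¹⊆U y∈ = proj₁ (proj₁ (∈-toSubset⁻ isRep? y∈))

    Y-complete : ∀ g → Σ (Fin n) λ y → y ∈ Y × SameRightCoset A y g
    Y-complete g with least (meets? g) (code-meets g)
    ... | z , z-least@((_ , gz∈) , _) = z ⁻¹ , ∈-toSubset⁺ isRep? z⁻¹-rep , z⁻¹∼g
      where
      z⁻¹∼g : SameRightCoset A (z ⁻¹) g
      z⁻¹∼g = subst (_∈ A) (⁻¹-anti-homo-∙ g z) (⁻¹-closed sA gz∈)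
      z⁻¹-rep : IsRep (z ⁻¹)
      z⁻¹-rep = subst (IsLeast (Meets (z ⁻¹))) (sym (⁻¹-involutive z))
                      (isLeast-resp-≐ (meets-resp z⁻¹∼g) z-least)

    Y-unique : ∀ y y′ → y ∈ Y → y′ ∈ Y → SameRightCoset A y′ y → y ≡ y′
    Y-unique y y′ y∈ y′∈ y′∼y = ⁻¹-injective
      (isLeast-unique (isLeast-resp-≐ (meets-resp y′∼y) (∈-toSubset⁻ isRep? y∈))
                      (∈-toSubset⁻ isRep? y′∈))

    U≐Y⁻¹H : (_∈ U) ≐ InvProd Y H
    U≐Y⁻¹H = U⊆Y⁻¹H , Y⁻¹H⊆U
      where
      U⊆Y⁻¹H : (_∈ U) ⊆ InvProd Y H
      U⊆Y⁻¹H {u} u∈ with Y-complete (u ⁻¹)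
      ... | y , y∈ , y∼u⁻¹ = y , y∈ , subst (λ x → x ∙ u ∈ H) (⁻¹-involutive y)
              (code-sameLeftCoset (Y⁻¹⊆U y∈) u∈
                (subst (_∈ A) (cong₂ _∙_ (sym (⁻¹-involutive y)) (⁻¹-involutive u)) y∼u⁻¹))

      Y⁻¹H⊆U : InvProd Y H ⊆ (_∈ U)
      Y⁻¹H⊆U {u} (y , y∈ , yu∈) =
        subst (_∈ U) eq (proj₁ conn ε (y ⁻¹) (y ∙ u) (ε∈ sH) (Y⁻¹⊆U y∈) yu∈)
        where
        eq : ε ∙ y ⁻¹ ∙ (y ∙ u) ≡ u
        eq = trans (cong (_∙ (y ∙ u)) (identityˡ (y ⁻¹))) (\\-leftDividesʳ y u)

    Y-invProdEqProd : InvProdEqProd G Y H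
    Y-invProdEqProd = inverseClosed⇒invProdEqProd sH
      λ u∈ → proj₁ U≐Y⁻¹H (proj₂ (proj₂ conn) _ (proj₂ U≐Y⁻¹H u∈))

    Y-meets-A∖H : Σ (Fin n) λ y → y ∈ Y × y ∈ A × y ∉ H
    Y-meets-A∖H with Y-complete ε
    ... | y , y∈ , y∼ε = y , y∈ , sameRightCoset-ε sA y∼ε ,
                         λ y∈H → proj₁ (proj₂ conn) (y ⁻¹) (⁻¹-closed sH y∈H) (Y⁻¹⊆U y∈)

  module TransversalToCode {H A Y : Sub G} (sH : IsSubgroup G H) (sA : IsSubgroup G A)
    (H⊆A : _⊆G_ G H A) (transversal : IsRightTransversal G A Y) (Y⁻¹H=HY : InvProdEqProd G Y H)
    {y₀ : Fin n} (y₀∈Y : y₀ ∈ Y) (y₀∈A : y₀ ∈ A) (y₀∉H : y₀ ∉ H) where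

    U : Sub G
    U = toSubset (invProd? Y H)

    ∈-U⁺ : ∀ {u} → InvProd Y H u → u ∈ U
    ∈-U⁺ = ∈-toSubset⁺ (invProd? Y H)

    ∈-U⁻ : ∀ {u} → u ∈ U → InvProd Y H u
    ∈-U⁻ = ∈-toSubset⁻ (invProd? Y H)

    closed : InverseClosed
    closed = invProdEqProd⇒inverseClosed sH Y⁻¹H=HY

    U-isCosetGraphSet : IsCosetGraphSet G H U
    U-isCosetGraphSet = doubleCosetClosed , disjoint , λ u u∈ → ∈-U⁺ (closed (∈-U⁻ u∈))
      where
      doubleCosetClosed : ∀ h u h′ → h ∈ H → u ∈ U → h′ ∈ H → h ∙ u ∙ h′ ∈ U
      doubleCosetClosed h u h′ h∈ u∈ h′∈ =
        ∈-U⁺ (invProd-∙ʳ sH (invProd-∙ˡ sH closed h∈ (∈-U⁻ u∈)) h′∈)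

      -- A witness y with yx ∈ H would lie in H ⊆ A, so it would be y₀ ∉ H.
      disjoint : ∀ x → x ∈ H → x ∉ U
      disjoint x x∈ x∈U with ∈-U⁻ x∈U
      ... | y , y∈ , yx∈ = y₀∉H (subst (_∈ H) y≡y₀ y∈H)
        where
        y∈H : y ∈ H
        y∈H = ∈-cancelʳ sH yx∈ x∈
        y≡y₀ : y ≡ y₀
        y≡y₀ = proj₂ transversal y y₀ y∈ y₀∈Y (∙-closed sA y₀∈A (⁻¹-closed sA (H⊆A y y∈H)))

    U-totalPerfectCode : IsTotalPerfectCodeOfCos G H U A
    U-totalPerfectCode g with proj₁ transversal g
    ... | y , y∈ , y∼g = g ∙ y ⁻¹ , sameRightCoset-sym sA y∼g , ∈-U⁺ adjacent , onlyNeighbour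
      where
      adjacent : InvProd Y H (g ⁻¹ ∙ (g ∙ y ⁻¹))
      adjacent = y , y∈ , subst (_∈ H) (sym yg⁻¹gy⁻¹≡ε) (ε∈ sH)
        where
        yg⁻¹gy⁻¹≡ε : y ∙ (g ⁻¹ ∙ (g ∙ y ⁻¹)) ≡ ε
        yg⁻¹gy⁻¹≡ε = trans (cong (y ∙_) (\\-leftDividesʳ g (y ⁻¹))) (inverseʳ y)

      onlyNeighbour : ∀ a′ → a′ ∈ A → g ⁻¹ ∙ a′ ∈ U → (g ∙ y ⁻¹) ⁻¹ ∙ a′ ∈ H
      onlyNeighbour a′ a′∈ a′∈U with ∈-U⁻ a′∈U
      ... | y′ , y′∈ , y′g⁻¹a′∈ = subst (_∈ H) eq y′g⁻¹a′∈
        where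
        y′∼g : SameRightCoset A y′ g
        y′∼g = ∈-cancelʳ sA (subst (_∈ A) (sym (assoc y′ (g ⁻¹) a′)) (H⊆A _ y′g⁻¹a′∈)) a′∈
        y≡y′ : y ≡ y′
        y≡y′ = proj₂ transversal y y′ y∈ y′∈
                 (sameRightCoset-trans sA y′∼g (sameRightCoset-sym sA y∼g))
        open ≡-Reasoning
        eq : y′ ∙ (g ⁻¹ ∙ a′) ≡ (g ∙ y ⁻¹) ⁻¹ ∙ a′
        eq = begin
          y′ ∙ (g ⁻¹ ∙ a′)     ≡⟨ cong (λ x → x ∙ (g ⁻¹ ∙ a′)) y≡y′ ⟨
          y ∙ (g ⁻¹ ∙ a′)      ≡⟨ assoc y (g ⁻¹) a′ ⟨
          y ∙ g ⁻¹ ∙ a′        ≡⟨ cong (_∙ a′) (⁻¹-anti-homo-// g y) ⟨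
          (g ∙ y ⁻¹) ⁻¹ ∙ a′   ∎

theorem4p2 : (G : FinGroup) (H A : Sub G) →
    IsSubgroup G H → IsSubgroup G A → _⊆G_ G H A →
    IsTotalPerfectCodeOfPair G H A ⇔
      Σ (Sub G) λ Y → IsRightTransversal G A Y × InvProdEqProd G Y H
        × Σ (Fin (FinGroup.n G)) λ y → (y ∈ Y) × (y ∈ A) × (y ∉ H)
theorem4p2 G H A sH sA H⊆A = mk⇔
  (λ (U , conn , code) → let open CodeToTransversal G sH sA conn code in
     Y , (Y-complete , Y-unique) , Y-invProdEqProd , Y-meets-A∖H)
  (λ (Y , transversal , Y⁻¹H=HY , _ , y₀∈Y , y₀∈A , y₀∉H) →
     let open TransversalToCode G sH sA H⊆A transversal Y⁻¹H=HY y₀∈Y y₀∈A y₀∉H in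
     U , U-isCosetGraphSet , U-totalPerfectCode)
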